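{- Let $a,b,c\in\mathbb{Z}$ with $c\neq0$ and $\delta=a^2-4bc^2\neq0$, and let $f(x)=c^2x^4+ax^2+b$. Then every integer solution $(x_0,y_0)\in\mathbb{Z}^2$ of $y^2=f(x)$ is of the form $$(x_0,|y_0|)=\left(\pm\sqrt{\frac{d_1+d_2-2a}{4c^2}},\ \left|\frac{d_1-d_2}{4c}\right|\right)$$ for some integers $d_1,d_2$ of the same parity with $d_1d_2=\delta$ (for which the square root is an integer). -}

module Defs where

open import Data.Integer using (ℤ; _+_; _-_; _*_; +_)
open import Data.Integer.Divisibility using (_∣_)

f : ℤ → ℤ → ℤ → ℤ → ℤ
f a b c x = c * c * (x * x * x * x) + a * (x * x) + b

δ : ℤ → ℤ → ℤ → ℤ
δ a b c = a * a - + 4 * b * (c * c)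

SameParity : ℤ → ℤ → Set
SameParity d₁ d₂ = + 2 ∣ (d₁ - d₂)

module Submission where

open import Defs
open import Data.Integer using (ℤ; _+_; _-_; _*_; +_; ∣_∣)
open import Data.Integer.Properties using (abs-*)
open import Data.Integer.Tactic.RingSolver using (solve-∀)
open import Data.Nat using () renaming (_*_ to _*ℕ_)
open import Data.Nat.Divisibility using (m∣m*n)
open import Data.Product using (∃₂; _×_; _,_)
open import Relation.Binary.PropositionalEquality
  using (_≡_; _≢_; cong; sym; module ≡-Reasoning)

open ≡-Reasoning

-- Multiplying y² = c²x⁴ + ax² + b by 4c² and completing the square gives
-- (2c²x² + a)² − (2cy)² = a² − 4bc² = δ, so d₁,₂ = 2c²x² + a ± 2cy factor δ,
-- with d₁ + d₂ = 4c²x² + 2a and d₁ − d₂ = 4cy.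

difference-of-squares : ∀ u v → (u + v) * (u - v) ≡ u * u - v * v
difference-of-squares = solve-∀

[u+v]-[u-v]≡2v : ∀ u v → (u + v) - (u - v) ≡ + 2 * v
[u+v]-[u-v]≡2v = solve-∀

sameParity-± : ∀ u v → SameParity (u + v) (u - v)
sameParity-± u v rewrite [u+v]-[u-v]≡2v u v | abs-* (+ 2) v = m∣m*n ∣ v ∣

completing-the-square : ∀ a b c x → let u = + 2 * (c * c) * (x * x) + a in
  u * u - + 4 * (c * c) * f a b c x ≡ δ a b c
completing-the-square a b c x = unfolded a b c x
  where
  -- The ring solver treats f and δ as atoms, so it is run on their unfoldings.
  unfolded : ∀ a b c x → let u = + 2 * (c * c) * (x * x) + a in
    u * u - + 4 * (c * c) * (c * c * (x * x * x * x) + a * (x * x) + b)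
      ≡ a * a - + 4 * b * (c * c)
  unfolded = solve-∀

sum-of-factors : ∀ a c x v → let u = + 2 * (c * c) * (x * x) + a in
  + 4 * (c * c) * (x * x) ≡ (u + v) + (u - v) - + 2 * a
sum-of-factors = solve-∀

∣[u+2cy]-[u-2cy]∣≡4∣c∣∣y∣ : ∀ u c y →
  ∣ (u + + 2 * c * y) - (u - + 2 * c * y) ∣ ≡ 4 *ℕ ∣ c ∣ *ℕ ∣ y ∣
∣[u+2cy]-[u-2cy]∣≡4∣c∣∣y∣ u c y = begin
  ∣ (u + + 2 * c * y) - (u - + 2 * c * y) ∣  ≡⟨ cong ∣_∣ ([u+2cy]-[u-2cy]≡4cy u c y) ⟩
  ∣ + 4 * c * y ∣                            ≡⟨ abs-* (+ 4 * c) y ⟩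
  ∣ + 4 * c ∣ *ℕ ∣ y ∣                       ≡⟨ cong (_*ℕ ∣ y ∣) (abs-* (+ 4) c) ⟩
  4 *ℕ ∣ c ∣ *ℕ ∣ y ∣                        ∎
  where
  [u+2cy]-[u-2cy]≡4cy : ∀ u c y → (u + + 2 * c * y) - (u - + 2 * c * y) ≡ + 4 * c * y
  [u+2cy]-[u-2cy]≡4cy = solve-∀

[2cy]²≡4c²y² : ∀ c y → + 2 * c * y * (+ 2 * c * y) ≡ + 4 * (c * c) * (y * y)
[2cy]²≡4c²y² = solve-∀

proposition2 : (a b c : ℤ) → c ≢ + 0 → δ a b c ≢ + 0 →
    (x₀ y₀ : ℤ) → y₀ * y₀ ≡ f a b c x₀ →
    ∃₂ λ (d₁ d₂ : ℤ) → SameParity d₁ d₂ × d₁ * d₂ ≡ δ a b c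
      × + 4 * (c * c) * (x₀ * x₀) ≡ d₁ + d₂ - + 2 * a
      × 4 *ℕ ∣ c ∣ *ℕ ∣ y₀ ∣ ≡ ∣ d₁ - d₂ ∣
proposition2 a b c _ _ x y y²≡f =
  u + v , u - v , sameParity-± u v , product ,
  sum-of-factors a c x v , sym (∣[u+2cy]-[u-2cy]∣≡4∣c∣∣y∣ u c y)
  where
  u v : ℤ
  u = + 2 * (c * c) * (x * x) + a
  v = + 2 * c * y
  product : (u + v) * (u - v) ≡ δ a b c
  product = begin
    (u + v) * (u - v)                  ≡⟨ difference-of-squares u v ⟩
    u * u - v * v                      ≡⟨ cong (u * u -_) ([2cy]²≡4c²y² c y) ⟩
    u * u - + 4 * (c * c) * (y * y)    ≡⟨ cong (λ t → u * u - + 4 * (c * c) * t) y²≡f ⟩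
    u * u - + 4 * (c * c) * f a b c x  ≡⟨ completing-the-square a b c x ⟩
    δ a b c                            ∎
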